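{- Let $a,b,c\ge 3$ be integers, at least one of which is not divisible by $4$. Put $P=(a-2)(b-2)(c-2)$, let $\delta=0$ if $\gcd(a,b,c)$ is odd and $\delta=2$ if $\gcd(a,b,c)$ is even, and for $n\in\mathbb{N}$ set $l_n=2^{3-\delta}Pn$ and $$v_{a,b,c}=2^{ -\delta}\big((a-4)^2(b-2)(c-2)+(a-2)(b-4)^2(c-2)+(a-2)(b-2)(c-4)^2\big).$$ Define the quadratic form $Q(x_1,x_2,x_3)=2^{2-\delta}P\big((a-2)x_1^2+(b-2)x_2^2+(c-2)x_3^2\big)$ and the vector $v=-\frac12\big(\frac{a-4}{a-2},\frac{b-4}{b-2},\frac{c-4}{c-2}\big)$. Then for every prime $p$ and every $n\in\mathbb{N}$ there exists $x\in\mathbb{Z}_p^3$ with $Q(x+v)=l_n+v_{a,b,c}$; i.e. $l_n+v_{a,b,c}$ is represented by the lattice coset $L_p+v$, where $L_p=\mathbb{Z}_p^3$ with quadratic form $Q$.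
   Context: $\mathbb{Z}_p$ denotes the $p$-adic integers and $\mathbb{N}=\{0,1,2,\dots\}$. -}

module Defs where

open import Data.Nat as ℕ using (ℕ; zero; suc)
open import Data.Nat.GCD using (gcd)
open import Data.Nat.Divisibility as ℕD using ()
open import Data.Integer using (ℤ; +_; _+_; _-_; _*_; _^_; _/_)
open import Data.Integer.Divisibility using (_∣_)
open import Data.Product using (Σ)
open import Relation.Nullary.Decidable using (does)
open import Data.Bool using (if_then_else_)

-- p-adic integers as the inverse limit  lim ℤ/p^k ℤ : a coherent sequence of
-- integer representatives x_k of residues mod p^k, x_{k+1} ≡ x_k (mod p^k).
record ℤ[_] (p : ℕ) : Set where
  constructor mkℤₚ
  field
    seq : ℕ → ℤ
    coh : ∀ k → (+ (p ℕ.^ k)) ∣ (seq (suc k) - seq k)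
open ℤ[_] public

-- For a polynomial f with integer coefficients, "f(x) = m in ℤ_p" means that
-- in every level ℤ/p^k of the inverse limit the componentwise value agrees
-- (ring operations of ℤ_p are componentwise).
RepresentedBy : (p : ℕ) → (ℤ → ℤ → ℤ → ℤ) → ℤ → Set
RepresentedBy p f m =
  Σ (ℤ[ p ]) λ x₁ → Σ (ℤ[ p ]) λ x₂ → Σ (ℤ[ p ]) λ x₃ →
    ∀ k → (+ (p ℕ.^ k)) ∣ (f (seq x₁ k) (seq x₂ k) (seq x₃ k) - m)

gcd₃ : ℕ → ℕ → ℕ → ℕ
gcd₃ a b c = gcd (gcd a b) c

twoPowδ : ℕ → ℕ → ℕ → ℤ
twoPowδ a b c = if does (2 ℕD.∣? gcd₃ a b c) then + 4 else + 1

twoPow3-δ : ℕ → ℕ → ℕ → ℤ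
twoPow3-δ a b c = if does (2 ℕD.∣? gcd₃ a b c) then + 2 else + 8

Pabc : ℕ → ℕ → ℕ → ℤ
Pabc a b c = (+ a - + 2) * (+ b - + 2) * (+ c - + 2)

lₙ : ℕ → ℕ → ℕ → ℕ → ℤ
lₙ a b c n = twoPow3-δ a b c * Pabc a b c * + n

vnum : ℕ → ℕ → ℕ → ℤ
vnum a b c =
    (+ a - + 4) ^ 2 * (+ b - + 2) * (+ c - + 2)
  + (+ a - + 2) * (+ b - + 4) ^ 2 * (+ c - + 2)
  + (+ a - + 2) * (+ b - + 2) * (+ c - + 4) ^ 2

-- v_{a,b,c} = 2^(-δ) * vnum (an exact division under the hypotheses)
vabc : ℕ → ℕ → ℕ → ℤ
vabc a b c = if does (2 ℕD.∣? gcd₃ a b c) then vnum a b c / + 4 else vnum a b c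

-- 2^δ · Q(x + v), with x = (x₁,x₂,x₃) and
-- v = -1/2((a-4)/(a-2),(b-4)/(b-2),(c-4)/(c-2)), after clearing denominators:
-- Q(x+v) = 2^(-δ) Σ (b-2)(c-2)(2(a-2)x₁ - (a-4))²  (cyclically).
scaledQshift : ℕ → ℕ → ℕ → ℤ → ℤ → ℤ → ℤ
scaledQshift a b c x₁ x₂ x₃ =
    (+ b - + 2) * (+ c - + 2) * (+ 2 * (+ a - + 2) * x₁ - (+ a - + 4)) ^ 2
  + (+ a - + 2) * (+ c - + 2) * (+ 2 * (+ b - + 2) * x₂ - (+ b - + 4)) ^ 2
  + (+ a - + 2) * (+ b - + 2) * (+ 2 * (+ c - + 2) * x₃ - (+ c - + 4)) ^ 2

module Submission where

-- Write A = a-2, B = b-2, C = c-2 and let pol A x = A x² + (2-A) x, twice the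
-- generalized (A+2)-gonal number.  Completing the square turns the claim into
--   2^δ Q(x+v) - 2^δ (l_n + v_{a,b,c}) = 4P (pol A x₁ + pol B x₂ + pol C x₃ - 2n)
-- once the factor 2^δ is cleared (this uses 4 ∣ vnum when gcd(a,b,c) is even).
-- So it suffices to solve  pol A x₁ + pol B x₂ + pol C x₃ = 2n  in ℤ_p.
--
-- The p-adic solutions are produced by Hensel's lemma for quadratic polynomials
-- with a unit derivative (Newton iteration, the inverse of F'(x₀) mod p comes
-- from Bézout).  It is applied to one coordinate, the others being fixed:
--  * p = 2: some A is odd or ≡ 0 mod 4 (since 4 ∤ a for some a), and then
--    pol A x = 2n alone is solvable in ℤ₂;
--  * p odd, p ∣ A: pol A x ≡ 2x (mod p), so pol A x = 2n alone is solvable;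
--  * p odd, p ∤ ABC: choose x₃ ∈ {0,1} with F'(x₃) a unit, then solve
--    pol A x₁ + pol B x₂ ≡ 2n - pol C x₃ (mod p) by pigeonhole, since each of
--    pol A, pol B takes (p+1)/2 distinct values mod p, and lift x₃.

open import Defs
open import Data.Nat using (ℕ; _≤_)
open import Data.Nat.Divisibility using (_∣_)
open import Data.Nat.Primality using (Prime)
open import Data.Integer using (_*_; _+_)
open import Data.Product using (_×_)
open import Relation.Nullary using (¬_)

open import Data.Nat as ℕ using (zero; suc; _<_; _∸_; _<?_; NonZero)
import Data.Nat.Properties as ℕP
import Data.Nat.Divisibility as ℕD
import Data.Nat.DivMod as ℕDM
open import Data.Nat.GCD using (gcd; gcd[m,n]∣m; gcd[m,n]∣n; module Bézout)
open import Data.Nat.Coprimality using (Coprime; coprime-Bézout)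
open import Data.Nat.Primality using (euclidsLemma; prime⇒irreducible; ¬prime[1])
open import Data.Integer as ℤ using (ℤ; +_; -_; _-_; _%_; _/_)
import Data.Integer.Properties as ℤP
import Data.Integer.DivMod as ℤDM
import Data.Integer.Divisibility as U
open import Data.Integer.Divisibility.Signed as S using (divides; ∣⇒∣ᵤ; ∣ᵤ⇒∣)
open import Data.Integer.Tactic.RingSolver using (solve-∀)
open import Data.Fin using (Fin; toℕ; fromℕ<)
open import Data.Fin.Properties using (pigeonhole; toℕ-fromℕ<; toℕ<n)
open import Data.Product using (Σ; _,_; proj₁; proj₂)
open import Data.Sum using (_⊎_; inj₁; inj₂; [_,_]′)
open import Data.Empty using (⊥; ⊥-elim)
open import Data.Bool using (if_then_else_)
open import Relation.Nullary using (Dec; yes; no; does)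
open import Relation.Binary.PropositionalEquality

open ≡-Reasoning

_^ᶻ_ : ℕ → ℕ → ℤ
p ^ᶻ k = + (p ℕ.^ k)

pos-+* : ∀ a b c → + (a ℕ.+ b ℕ.* c) ≡ + a + + b * + c
pos-+* a b c = trans (ℤP.pos-+ a (b ℕ.* c)) (cong (λ z → + a + z) (ℤP.pos-* b c))

¬∣-small : ∀ {p n} → 0 < n → n < p → ¬ (+ p S.∣ + n)
¬∣-small {p} {n} 0<n n<p p∣n =
  ℕP.<⇒≱ n<p (ℕD.∣⇒≤ {{ℕ.>-nonZero 0<n}} (∣⇒∣ᵤ p∣n))

euclid : ∀ {p} → Prime p → ∀ x y → + p S.∣ x * y → + p S.∣ x ⊎ + p S.∣ y
euclid p-prime x y p∣xy
  with euclidsLemma ℤ.∣ x ∣ ℤ.∣ y ∣ p-prime (subst (_ ℕD.∣_) (ℤP.abs-* x y) (∣⇒∣ᵤ p∣xy))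
... | inj₁ p∣x = inj₁ (∣ᵤ⇒∣ p∣x)
... | inj₂ p∣y = inj₂ (∣ᵤ⇒∣ p∣y)

%-≡⇒∣- : ∀ a b d .{{_ : ℤ.NonZero d}} → a % d ≡ b % d → d S.∣ a - b
%-≡⇒∣- a b d a%d≡b%d = divides (a / d - b / d) (begin
  a - b
    ≡⟨ cong₂ _-_ (ℤDM.a≡a%n+[a/n]*n a d) (ℤDM.a≡a%n+[a/n]*n b d) ⟩
  (+ (a % d) + a / d * d) - (+ (b % d) + b / d * d)
    ≡⟨ cong (λ r → (+ r + a / d * d) - (+ (b % d) + b / d * d)) a%d≡b%d ⟩
  (+ (b % d) + a / d * d) - (+ (b % d) + b / d * d)
    ≡⟨ cancel (+ (b % d)) (a / d) (b / d) d ⟩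
  (a / d - b / d) * d ∎)
  where
  cancel : ∀ r x y d → (r + x * d) - (r + y * d) ≡ (x - y) * d
  cancel = solve-∀

exact-/ : ∀ d .{{_ : NonZero d}} V → + d S.∣ V → V ≡ V / + d * + d
exact-/ d V d∣V with V % + d | ℤDM.a≡a%n+[a/n]*n V (+ d) | ℤDM.n%d<d V (+ d)
... | zero  | V≡ | _     = trans V≡ (ℤP.+-identityˡ _)
... | suc r | V≡ | r<d   = ⊥-elim (¬∣-small (ℕ.s≤s ℕ.z≤n) r<d d∣r)
  where
  d∣r : + d S.∣ + suc r
  d∣r = S.∣m+n∣n⇒∣m (subst (+ d S.∣_) V≡ d∣V) (S.∣n⇒∣m*n (V / + d) S.∣-refl)

record Unit (p : ℕ) (D : ℤ) : Set where
  constructor unit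
  field
    w c : ℤ
    inverts : D * w ≡ + 1 + c * + p

prime⇒unit : ∀ {p} → Prime p → ∀ D → ¬ (+ p S.∣ D) → Unit p D
prime⇒unit {p} p-prime D p∤D = fromAbs (fromBézout (coprime-Bézout coprime))
  where
  coprime : Coprime ℤ.∣ D ∣ p
  coprime (d∣D , d∣p) with prime⇒irreducible p-prime d∣p
  ... | inj₁ d≡1    = d≡1
  ... | inj₂ refl   = ⊥-elim (p∤D (∣ᵤ⇒∣ d∣D))

  fromBézout : Bézout.Identity 1 ℤ.∣ D ∣ p → Unit p (+ ℤ.∣ D ∣)
  fromBézout (Bézout.+- x y 1+yp≡xD) = unit (+ x) (+ y) (begin
    + ℤ.∣ D ∣ * + x    ≡⟨ ℤP.*-comm (+ ℤ.∣ D ∣) (+ x) ⟩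
    + x * + ℤ.∣ D ∣    ≡⟨ sym (ℤP.pos-* x ℤ.∣ D ∣) ⟩
    + (x ℕ.* ℤ.∣ D ∣)  ≡⟨ cong +_ (sym 1+yp≡xD) ⟩
    + (1 ℕ.+ y ℕ.* p)  ≡⟨ pos-+* 1 y p ⟩
    + 1 + + y * + p    ∎)
  fromBézout (Bézout.-+ x y 1+xD≡yp) = unit (- + x) (- + y) (begin
    + ℤ.∣ D ∣ * - + x                 ≡⟨ flip (+ ℤ.∣ D ∣) (+ x) ⟩
    + 1 - (+ 1 + + x * + ℤ.∣ D ∣)     ≡⟨ cong (λ z → + 1 - z) (sym (pos-+* 1 x ℤ.∣ D ∣)) ⟩
    + 1 - + (1 ℕ.+ x ℕ.* ℤ.∣ D ∣)    ≡⟨ cong (λ z → + 1 - + z) 1+xD≡yp ⟩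
    + 1 - + (y ℕ.* p)                 ≡⟨ cong (λ z → + 1 - z) (ℤP.pos-* y p) ⟩
    + 1 - + y * + p                   ≡⟨ negate (+ y) (+ p) ⟩
    + 1 + - + y * + p                 ∎)
    where
    flip : ∀ D x → D * - x ≡ + 1 - (+ 1 + x * D)
    flip = solve-∀
    negate : ∀ y p → + 1 - y * p ≡ + 1 + - y * p
    negate = solve-∀

  fromAbs : Unit p (+ ℤ.∣ D ∣) → Unit p D
  fromAbs (unit w c eq) with ℤP.+∣i∣≡i⊎+∣i∣≡-i D
  ... | inj₁ ∣D∣≡D  = unit w c (subst (λ E → E * w ≡ + 1 + c * + p) ∣D∣≡D eq)
  ... | inj₂ ∣D∣≡-D = unit (- w) c
    (trans (swap D w) (subst (λ E → E * w ≡ + 1 + c * + p) ∣D∣≡-D eq))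
    where
    swap : ∀ D w → D * - w ≡ - D * w
    swap = solve-∀

const : ∀ {p} → ℤ → ℤ[ p ]
const {p} z = mkℤₚ (λ _ → z) (λ k → ∣⇒∣ᵤ {p ^ᶻ k} (divides (+ 0) (zero≡ z (p ^ᶻ k))))
  where
  zero≡ : ∀ z q → z - z ≡ + 0 * q
  zero≡ = solve-∀

Root : ℕ → (ℤ → ℤ) → Set
Root p f = Σ ℤ[ p ] λ x → ∀ k → p ^ᶻ k S.∣ f (seq x k)

root-multiple : ∀ {p f h} c → (∀ x → f x ≡ c * h x) → Root p h → Root p f
root-multiple {p} c f≡ch (x , root) =
  x , λ k → subst (p ^ᶻ k S.∣_) (sym (f≡ch (seq x k))) (S.∣n⇒∣m*n c (root k))

quad : ℤ → ℤ → ℤ → ℤ → ℤ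
quad α β γ x = α * x * x + β * x + γ

taylor : ∀ α β γ y h → quad α β γ (y + h) ≡ quad α β γ y + h * (+ 2 * α * y + β) + α * h * h
taylor α β γ y h = expansion α β γ y h
  where
  expansion : ∀ α β γ y h →
    α * (y + h) * (y + h) + β * (y + h) + γ
      ≡ (α * y * y + β * y + γ) + h * (+ 2 * α * y + β) + α * h * h
  expansion = solve-∀

-- One Newton step.  If F(y) = s·Q with Q = P·q and y ≡ x₀ (mod P), and w inverts
-- F'(x₀) modulo P, then the correction y ↦ y - Q·s·w makes F vanish modulo P·Q.
newton-step : ∀ α β γ x₀ e w c P q s →
  (+ 2 * α * x₀ + β) * w ≡ + 1 + c * P →
  quad α β γ (x₀ + e * P) ≡ s * (P * q) →
  quad α β γ (x₀ + e * P + P * q * - (s * w))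
    ≡ (α * q * s * w * s * w - + 2 * α * e * s * w - s * c) * (P * (P * q))
newton-step α β γ x₀ e w c P q s inverse F[y]≡ = begin
  F (y + Q * t)
    ≡⟨ taylor α β γ y (Q * t) ⟩
  F y + Q * t * (+ 2 * α * y + β) + α * (Q * t) * (Q * t)
    ≡⟨ cong (λ z → z + Q * t * (+ 2 * α * y + β) + α * (Q * t) * (Q * t)) F[y]≡ ⟩
  s * Q + Q * t * (+ 2 * α * y + β) + α * (Q * t) * (Q * t)
    ≡⟨ expand α β x₀ e w P q s ⟩
  Q * s * (+ 1 - (+ 2 * α * x₀ + β) * w) + R * (P * Q)
    ≡⟨ cong (λ z → Q * s * (+ 1 - z) + R * (P * Q)) inverse ⟩
  Q * s * (+ 1 - (+ 1 + c * P)) + R * (P * Q)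
    ≡⟨ collect R s c P q ⟩
  (R - s * c) * (P * Q) ∎
  where
  F = quad α β γ
  y = x₀ + e * P
  Q = P * q
  t = - (s * w)
  R = α * q * s * w * s * w - + 2 * α * e * s * w
  expand : ∀ α β x₀ e w P q s →
    s * (P * q) + P * q * - (s * w) * (+ 2 * α * (x₀ + e * P) + β)
      + α * (P * q * - (s * w)) * (P * q * - (s * w))
    ≡ P * q * s * (+ 1 - (+ 2 * α * x₀ + β) * w)
      + (α * q * s * w * s * w - + 2 * α * e * s * w) * (P * (P * q))
  expand = solve-∀
  collect : ∀ R s c P q → P * q * s * (+ 1 - (+ 1 + c * P)) + R * (P * (P * q))
                         ≡ (R - s * c) * (P * (P * q))
  collect = solve-∀

hensel : ∀ {p} α β γ x₀ → Unit p (+ 2 * α * x₀ + β) → + p S.∣ quad α β γ x₀ →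
         Root p (quad α β γ)
hensel {p} α β γ x₀ (unit w c inverse) (divides s₀ F[x₀]≡) =
  mkℤₚ (λ k → Approx.y (approx k)) coherent , λ k → isRoot (approx k)
  where
  F = quad α β γ

  record Approx (k : ℕ) : Set where
    field
      y e s : ℤ
      over : y ≡ x₀ + e * + p
      root : F y ≡ s * (+ p * p ^ᶻ k)

  start : Approx 0
  start = record
    { y = x₀ ; e = + 0 ; s = s₀
    ; over = sym (ℤP.+-identityʳ x₀)
    ; root = trans F[x₀]≡ (cong (s₀ *_) (sym (ℤP.*-identityʳ (+ p)))) }

  next : ∀ {k} → Approx k → Approx (suc k)
  next {k} a = record
    { y = y + Q * t ; e = e + p ^ᶻ k * t ; s = s′
    ; over = trans (cong (λ z → z + Q * t) over) (shift x₀ e (+ p) (p ^ᶻ k) t)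
    ; root = begin
        F (y + Q * t)
          ≡⟨ cong (λ z → F (z + Q * t)) over ⟩
        F (x₀ + e * + p + Q * t)
          ≡⟨ newton-step α β γ x₀ e w c (+ p) (p ^ᶻ k) s inverse
               (trans (cong F (sym over)) root) ⟩
        s′ * (+ p * Q)
          ≡⟨ cong (λ z → s′ * (+ p * z)) (sym (ℤP.pos-* p (p ℕ.^ k))) ⟩
        s′ * (+ p * p ^ᶻ suc k) ∎ }
    where
    open Approx a
    Q = + p * p ^ᶻ k
    t = - (s * w)
    s′ = α * p ^ᶻ k * s * w * s * w - + 2 * α * e * s * w - s * c
    shift : ∀ x₀ e P q t → x₀ + e * P + P * q * t ≡ x₀ + (e + q * t) * P
    shift = solve-∀

  approx : ∀ k → Approx k
  approx zero    = start
  approx (suc k) = next (approx k)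

  coherent : ∀ k → p ^ᶻ k U.∣ Approx.y (approx (suc k)) - Approx.y (approx k)
  coherent k = ∣⇒∣ᵤ (divides (+ p * - (Approx.s a * w)) (step (Approx.y a) (+ p) (p ^ᶻ k) _))
    where
    a = approx k
    step : ∀ y P q t → (y + P * q * t) - y ≡ (P * t) * q
    step = solve-∀

  isRoot : ∀ {k} (a : Approx k) → p ^ᶻ k S.∣ F (Approx.y a)
  isRoot {k} a = divides (s * + p) (trans root (reassoc s (+ p) (p ^ᶻ k)))
    where
    open Approx a
    reassoc : ∀ s P q → s * (P * q) ≡ (s * P) * q
    reassoc = solve-∀

pol : ℤ → ℤ → ℤ
pol A x = A * x * x + (+ 2 - A) * x

record PolygonalRep (p : ℕ) (A B C N : ℤ) : Set where
  constructor solution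
  field
    x₁ x₂ x₃ : ℤ[ p ]
    solves : ∀ k → p ^ᶻ k S.∣ pol A (seq x₁ k) + pol B (seq x₂ k) + pol C (seq x₃ k) - + 2 * N

rotate : ∀ {p A B C N} → PolygonalRep p B C A N → PolygonalRep p A B C N
rotate {p} {A} {B} {C} {N} (solution x₂ x₃ x₁ rep) =
  solution x₁ x₂ x₃ λ k →
    subst (p ^ᶻ k S.∣_) (cycle (pol B (seq x₂ k)) (pol C (seq x₃ k)) (pol A (seq x₁ k)) (+ 2 * N)) (rep k)
  where
  cycle : ∀ G₂ G₃ G₁ M → G₂ + G₃ + G₁ - M ≡ G₁ + G₂ + G₃ - M
  cycle = solve-∀

lastCoordinate : ∀ {p A B C N} x₁ x₂ →
  Root p (quad C (+ 2 - C) (pol A x₁ + pol B x₂ - + 2 * N)) → PolygonalRep p A B C N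
lastCoordinate {p} {A} {B} {C} {N} x₁ x₂ (x₃ , root) =
  solution (const x₁) (const x₂) x₃ λ k →
    subst (p ^ᶻ k S.∣_) (reorder (pol A x₁) (pol B x₂) C (seq x₃ k) (+ 2 * N)) (root k)
  where
  reorder : ∀ G₁ G₂ C x M →
    C * x * x + (+ 2 - C) * x + (G₁ + G₂ - M) ≡ G₁ + G₂ + (C * x * x + (+ 2 - C) * x) - M
  reorder = solve-∀

clear-2^δ : ∀ {G} (d : Dec (2 ℕD.∣ G)) P V n → (2 ℕD.∣ G → + 4 S.∣ V) →
  (if does d then + 4 else + 1)
    * ((if does d then + 2 else + 8) * P * + n + (if does d then V / + 4 else V))
  ≡ + 8 * P * + n + V
clear-2^δ (no _) P V n _ = unit-factor P V (+ n)
  where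
  unit-factor : ∀ P V n → + 1 * (+ 8 * P * n + V) ≡ + 8 * P * n + V
  unit-factor = solve-∀
clear-2^δ (yes 2∣G) P V n 4∣V =
  trans (distribute P (V / + 4) (+ n))
        (cong (λ z → + 8 * P * + n + z) (sym (exact-/ 4 V (4∣V 2∣G))))
  where
  distribute : ∀ P W n → + 4 * (+ 2 * P * n + W) ≡ + 8 * P * n + W * + 4
  distribute = solve-∀

-- vnum as a polynomial in integer variables (vnum a b c unfolds to vnumℤ (+ a) (+ b) (+ c)).
vnumℤ : ℤ → ℤ → ℤ → ℤ
vnumℤ a b c =
    (a - + 4) ℤ.^ 2 * (b - + 2) * (c - + 2)
  + (a - + 2) * (b - + 4) ℤ.^ 2 * (c - + 2)
  + (a - + 2) * (b - + 2) * (c - + 4) ℤ.^ 2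

Even : ℤ → Set
Even x = Σ ℤ λ h → x ≡ h * + 2

-- For even a, b, c every term of vnum is divisible by 16, in particular by 4.
4∣vnumℤ : ∀ {a b c} → Even a → Even b → Even c → + 4 S.∣ vnumℤ a b c
4∣vnumℤ (a′ , refl) (b′ , refl) (c′ , refl) = divides (+ 4 * K a′ b′ c′) (expand a′ b′ c′)
  where
  K : ℤ → ℤ → ℤ → ℤ
  K a b c = (a - + 2) * (a - + 2) * (b - + 1) * (c - + 1)
          + (a - + 1) * (b - + 2) * (b - + 2) * (c - + 1)
          + (a - + 1) * (b - + 1) * (c - + 2) * (c - + 2)
  -- (the squares x ^ 2 unfold to x * (x * + 1))
  expand : ∀ a b c →
      (a * + 2 - + 4) * ((a * + 2 - + 4) * + 1) * (b * + 2 - + 2) * (c * + 2 - + 2)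
    + (a * + 2 - + 2) * ((b * + 2 - + 4) * ((b * + 2 - + 4) * + 1)) * (c * + 2 - + 2)
    + (a * + 2 - + 2) * (b * + 2 - + 2) * ((c * + 2 - + 4) * ((c * + 2 - + 4) * + 1))
    ≡ + 4 * ( (a - + 2) * (a - + 2) * (b - + 1) * (c - + 1)
            + (a - + 1) * (b - + 2) * (b - + 2) * (c - + 1)
            + (a - + 1) * (b - + 1) * (c - + 2) * (c - + 2)) * + 4
  expand = solve-∀

4∣vnum : ∀ a b c → 2 ℕD.∣ gcd₃ a b c → + 4 S.∣ vnum a b c
4∣vnum a b c 2∣g = 4∣vnumℤ (even 2∣a) (even 2∣b) (even 2∣c)
  where
  even : ∀ {n} → 2 ℕD.∣ n → Even (+ n)
  even (ℕD.divides h n≡) = + h , trans (cong +_ n≡) (ℤP.pos-* h 2)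
  2∣gcd[a,b] = ℕD.∣-trans 2∣g (gcd[m,n]∣m (gcd a b) c)
  2∣a = ℕD.∣-trans 2∣gcd[a,b] (gcd[m,n]∣m a b)
  2∣b = ℕD.∣-trans 2∣gcd[a,b] (gcd[m,n]∣n a b)
  2∣c = ℕD.∣-trans 2∣g (gcd[m,n]∣n (gcd a b) c)

-- Completing the square (squares x ^ 2 written out as x * (x * + 1)):
--   2^δ Q(x+v) - (8 P n + vnum) = 4 P (pol A x₁ + pol B x₂ + pol C x₃ - 2n).
completeSquare : ∀ a b c x₁ x₂ x₃ n →
    ( (b - + 2) * (c - + 2) * ((+ 2 * (a - + 2) * x₁ - (a - + 4)) * ((+ 2 * (a - + 2) * x₁ - (a - + 4)) * + 1))
    + (a - + 2) * (c - + 2) * ((+ 2 * (b - + 2) * x₂ - (b - + 4)) * ((+ 2 * (b - + 2) * x₂ - (b - + 4)) * + 1))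
    + (a - + 2) * (b - + 2) * ((+ 2 * (c - + 2) * x₃ - (c - + 4)) * ((+ 2 * (c - + 2) * x₃ - (c - + 4)) * + 1)))
  - ( + 8 * ((a - + 2) * (b - + 2) * (c - + 2)) * n
    + ( (a - + 4) * ((a - + 4) * + 1) * (b - + 2) * (c - + 2)
      + (a - + 2) * ((b - + 4) * ((b - + 4) * + 1)) * (c - + 2)
      + (a - + 2) * (b - + 2) * ((c - + 4) * ((c - + 4) * + 1))))
  ≡ + 4 * ((a - + 2) * (b - + 2) * (c - + 2))
      * ( ((a - + 2) * x₁ * x₁ + (+ 2 - (a - + 2)) * x₁)
        + ((b - + 2) * x₂ * x₂ + (+ 2 - (b - + 2)) * x₂)
        + ((c - + 2) * x₃ * x₃ + (+ 2 - (c - + 2)) * x₃) - + 2 * n)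
completeSquare = solve-∀

fromPolygonal : ∀ {p} a b c n → PolygonalRep p (+ a - + 2) (+ b - + 2) (+ c - + 2) (+ n) →
  RepresentedBy p (scaledQshift a b c) (twoPowδ a b c * (lₙ a b c n + vabc a b c))
fromPolygonal {p} a b c n (solution x₁ x₂ x₃ rep) = x₁ , x₂ , x₃ , λ k →
  ∣⇒∣ᵤ (subst (p ^ᶻ k S.∣_) (difference k) (S.∣n⇒∣m*n (+ 4 * Pabc a b c) (rep k)))
  where
  target≡ : twoPowδ a b c * (lₙ a b c n + vabc a b c) ≡ + 8 * Pabc a b c * + n + vnum a b c
  target≡ = clear-2^δ (2 ℕD.∣? gcd₃ a b c) (Pabc a b c) (vnum a b c) n (4∣vnum a b c)

  difference : ∀ k → + 4 * Pabc a b c * (pol (+ a - + 2) (seq x₁ k) + pol (+ b - + 2) (seq x₂ k)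
                                          + pol (+ c - + 2) (seq x₃ k) - + 2 * + n)
    ≡ scaledQshift a b c (seq x₁ k) (seq x₂ k) (seq x₃ k) - twoPowδ a b c * (lₙ a b c n + vabc a b c)
  difference k = trans (sym (completeSquare (+ a) (+ b) (+ c) (seq x₁ k) (seq x₂ k) (seq x₃ k) (+ n)))
                       (cong (λ z → scaledQshift a b c (seq x₁ k) (seq x₂ k) (seq x₃ k) - z) (sym target≡))

TwoAdicShape : ℤ → Set
TwoAdicShape A = (Σ ℤ λ L → A ≡ + 2 * L + + 1) ⊎ (Σ ℤ λ L → A ≡ L * + 4)

residueShape : ∀ r q → 0 < r → r < 4 → TwoAdicShape (+ r + q * + 4 - + 2)
residueShape 1 q _ _ = inj₁ (+ 2 * q - + 1 , odd q)
  where
  odd : ∀ q → + 1 + q * + 4 - + 2 ≡ + 2 * (+ 2 * q - + 1) + + 1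
  odd = solve-∀
residueShape 2 q _ _ = inj₂ (q , four q)
  where
  four : ∀ q → + 2 + q * + 4 - + 2 ≡ q * + 4
  four = solve-∀
residueShape 3 q _ _ = inj₁ (+ 2 * q , odd q)
  where
  odd : ∀ q → + 3 + q * + 4 - + 2 ≡ + 2 * (+ 2 * q) + + 1
  odd = solve-∀
residueShape (suc (suc (suc (suc _)))) _ _ (ℕ.s≤s (ℕ.s≤s (ℕ.s≤s (ℕ.s≤s ()))))

shape : ∀ a → ¬ 4 ∣ a → TwoAdicShape (+ a - + 2)
shape a 4∤a = subst (λ z → TwoAdicShape (z - + 2)) (sym a≡)
  (residueShape (a ℕ.% 4) (+ (a ℕ./ 4)) (ℕP.n≢0⇒n>0 (λ r≡0 → 4∤a (ℕD.m%n≡0⇒n∣m a 4 r≡0)))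
                (ℕDM.m%n<n a 4))
  where
  a≡ : + a ≡ + (a ℕ.% 4) + + (a ℕ./ 4) * + 4
  a≡ = trans (cong +_ (ℕDM.m≡m%n+[m/n]*n a 4)) (pos-+* (a ℕ.% 4) (a ℕ./ 4) 4)

-- In ℤ₂ the equation pol C x = 2N (x₁ = x₂ = 0) is solvable when C is odd or
-- divisible by 4: for odd C, F' is odd at x = 0; for C = 4L one solves
-- (pol C x - 2N)/2 = 2L x² + (1 - 2L) x - N, whose derivative is odd everywhere.
twoAdicLast : ∀ {A B C N} → TwoAdicShape C → PolygonalRep 2 A B C N
twoAdicLast {A} {B} {N = N} (inj₁ (L , refl)) =
  lastCoordinate (+ 0) (+ 0)
    (hensel C (+ 2 - C) γ (+ 0) (unit (+ 1) (- L) (inverts L)) (divides (- N) (root₀ A B L N)))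
  where
  C = + 2 * L + + 1
  γ = pol A (+ 0) + pol B (+ 0) - + 2 * N
  inverts : ∀ L → (+ 2 * (+ 2 * L + + 1) * + 0 + (+ 2 - (+ 2 * L + + 1))) * + 1 ≡ + 1 + - L * + 2
  inverts = solve-∀
  root₀ : ∀ A B L N →
    (+ 2 * L + + 1) * + 0 * + 0 + (+ 2 - (+ 2 * L + + 1)) * + 0
      + ((A * + 0 * + 0 + (+ 2 - A) * + 0) + (B * + 0 * + 0 + (+ 2 - B) * + 0) - + 2 * N)
    ≡ - N * + 2
  root₀ = solve-∀
twoAdicLast {A} {B} {N = N} (inj₂ (L , refl)) =
  lastCoordinate (+ 0) (+ 0)
    (root-multiple {h = quad (+ 2 * L) (+ 1 - + 2 * L) (- N)} (+ 2) (halve A B L N)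
    (hensel (+ 2 * L) (+ 1 - + 2 * L) (- N) N (unit (+ 1) (+ 2 * L * N - L) (inverts L N))
            (divides (L * N * (N - + 1)) (rootN L N))))
  where
  halve : ∀ A B L N x →
    L * + 4 * x * x + (+ 2 - L * + 4) * x
      + ((A * + 0 * + 0 + (+ 2 - A) * + 0) + (B * + 0 * + 0 + (+ 2 - B) * + 0) - + 2 * N)
    ≡ + 2 * (+ 2 * L * x * x + (+ 1 - + 2 * L) * x + - N)
  halve = solve-∀
  inverts : ∀ L N → (+ 2 * (+ 2 * L) * N + (+ 1 - + 2 * L)) * + 1 ≡ + 1 + (+ 2 * L * N - L) * + 2
  inverts = solve-∀
  rootN : ∀ L N → + 2 * L * N * N + (+ 1 - + 2 * L) * N + - N ≡ L * N * (N - + 1) * + 2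
  rootN = solve-∀

twoAdicRep : ∀ {a b c} N → ¬ (4 ∣ a × 4 ∣ b × 4 ∣ c) →
             PolygonalRep 2 (+ a - + 2) (+ b - + 2) (+ c - + 2) N
twoAdicRep {a} {b} {c} N ¬4∣abc with 4 ℕD.∣? a | 4 ℕD.∣? b | 4 ℕD.∣? c
... | no 4∤a  | _       | _       = rotate (twoAdicLast (shape a 4∤a))
... | yes _   | no 4∤b  | _       = rotate (rotate (twoAdicLast (shape b 4∤b)))
... | yes _   | yes _   | no 4∤c  = twoAdicLast (shape c 4∤c)
... | yes 4∣a | yes 4∣b | yes 4∣c = ⊥-elim (¬4∣abc (4∣a , 4∣b , 4∣c))

2<oddPrime : ∀ m → Prime (suc (m ℕ.+ m)) → 2 < suc (m ℕ.+ m)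
2<oddPrime zero    p-prime = ⊥-elim (¬prime[1] p-prime)
2<oddPrime (suc m) _       = ℕ.s≤s (ℕ.s≤s (ℕP.≤-trans (ℕ.s≤s ℕ.z≤n) (ℕP.m≤n+m (suc m) m)))

neg-difference : ∀ u v → u ℕ.≤ v → - (+ u - + v) ≡ + (v ∸ u)
neg-difference u v u≤v = trans (negate (+ u) (+ v)) (trans (ℤP.-m+n≡n⊖m u v) (ℤP.⊖-≥ u≤v))
  where
  negate : ∀ u v → - (u - v) ≡ - u + v
  negate = solve-∀

module OddPrime (m : ℕ) (p-prime : Prime (suc (m ℕ.+ m))) where

  p h : ℕ
  p = suc (m ℕ.+ m)
  h = suc m

  2h≡1+p : + 2 * + h ≡ + 1 + + p
  2h≡1+p = begin
    + 2 * + h          ≡⟨ sym (ℤP.pos-* 2 h) ⟩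
    + (2 ℕ.* h)        ≡⟨ cong (λ z → + suc z) (trans (cong (m ℕ.+_) (ℕP.+-identityʳ h))
                                                      (ℕP.+-suc m m)) ⟩
    + (1 ℕ.+ p)        ≡⟨ ℤP.pos-+ 1 p ⟩
    + 1 + + p          ∎

  -- If p ∣ C then pol C x ≡ 2x (mod p), so x₃ = N is a simple root modulo p
  -- of pol C x₃ = 2N (with x₁ = x₂ = 0).
  divisibleLast : ∀ {A B C N} → + p S.∣ C → PolygonalRep p A B C N
  divisibleLast {A} {B} {N = N} (divides K refl) =
    lastCoordinate (+ 0) (+ 0)
      (hensel C (+ 2 - C) γ N (unit (+ h) ((+ 2 * K * N - K) * + h + + 1) inverts)
              (divides (K * N * (N - + 1)) (rootN A B K N (+ p))))
    where
    C = K * + p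
    γ = pol A (+ 0) + pol B (+ 0) - + 2 * N
    rootN : ∀ A B K N P →
      K * P * N * N + (+ 2 - K * P) * N
        + ((A * + 0 * + 0 + (+ 2 - A) * + 0) + (B * + 0 * + 0 + (+ 2 - B) * + 0) - + 2 * N)
      ≡ K * N * (N - + 1) * P
    rootN = solve-∀
    inverts : (+ 2 * C * N + (+ 2 - C)) * + h ≡ + 1 + ((+ 2 * K * N - K) * + h + + 1) * + p
    inverts = begin
      (+ 2 * C * N + (+ 2 - C)) * + h
        ≡⟨ split K N (+ h) (+ p) ⟩
      (+ 2 * K * N - K) * + h * + p + + 2 * + h
        ≡⟨ cong (λ z → (+ 2 * K * N - K) * + h * + p + z) 2h≡1+p ⟩
      (+ 2 * K * N - K) * + h * + p + (+ 1 + + p)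
        ≡⟨ regroup K N (+ h) (+ p) ⟩
      + 1 + ((+ 2 * K * N - K) * + h + + 1) * + p ∎
      where
      split : ∀ K N h P → (+ 2 * (K * P) * N + (+ 2 - K * P)) * h ≡ (+ 2 * K * N - K) * h * P + + 2 * h
      split = solve-∀
      regroup : ∀ K N h P → (+ 2 * K * N - K) * h * P + (+ 1 + P) ≡ + 1 + ((+ 2 * K * N - K) * h + + 1) * P
      regroup = solve-∀

  -- For a unit A with inverse α, the point s = (A - 2)·α·h is where the derivative
  -- 2 A x + (2 - A) of pol A vanishes modulo p.
  centre : ∀ {A} → Unit p A → ℤ
  centre {A} (unit α _ _) = (A - + 2) * α * + h

  centred-difference : ∀ {A} (U : Unit p A) u v → Σ ℤ λ K →
    pol A (centre U + u) - pol A (centre U + v) ≡ (u - v) * (A * (u + v) + + p * K)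
  centred-difference {A} (unit α c Aα≡) u v = (A - + 2) * (c * + p + c + + 1) , (begin
    pol A (s + u) - pol A (s + v)
      ≡⟨ expand A α (+ h) u v ⟩
    (u - v) * (A * (u + v) + (A - + 2) * (A * α * (+ 2 * + h) - + 1))
      ≡⟨ cong₂ (λ y z → (u - v) * (A * (u + v) + (A - + 2) * (y * z - + 1))) Aα≡ 2h≡1+p ⟩
    (u - v) * (A * (u + v) + (A - + 2) * ((+ 1 + c * + p) * (+ 1 + + p) - + 1))
      ≡⟨ factor A c u v (+ p) ⟩
    (u - v) * (A * (u + v) + + p * ((A - + 2) * (c * + p + c + + 1))) ∎)
    where
    s = (A - + 2) * α * + h
    expand : ∀ A α h u v →
      (A * ((A - + 2) * α * h + u) * ((A - + 2) * α * h + u) + (+ 2 - A) * ((A - + 2) * α * h + u))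
        - (A * ((A - + 2) * α * h + v) * ((A - + 2) * α * h + v) + (+ 2 - A) * ((A - + 2) * α * h + v))
      ≡ (u - v) * (A * (u + v) + (A - + 2) * (A * α * (+ 2 * h) - + 1))
    expand = solve-∀
    factor : ∀ A c u v P →
      (u - v) * (A * (u + v) + (A - + 2) * ((+ 1 + c * P) * (+ 1 + P) - + 1))
        ≡ (u - v) * (A * (u + v) + P * ((A - + 2) * (c * P + c + + 1)))
    factor = solve-∀

  distinct : ∀ {A} → ¬ (+ p S.∣ A) → (U : Unit p A) → ∀ {u v} → u < v → v < h →
    ¬ (+ p S.∣ pol A (centre U + + u) - pol A (centre U + + v))
  distinct {A} ¬p∣A U {u} {v} u<v v<h p∣difference = byFactors (centred-difference U (+ u) (+ v))
    where
    ¬p∣u-v : ¬ (+ p S.∣ + u - + v)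
    ¬p∣u-v p∣u-v = ¬∣-small (ℕP.m<n⇒0<n∸m u<v) v∸u<p
                     (subst (+ p S.∣_) (neg-difference u v (ℕP.<⇒≤ u<v)) (S.∣m⇒∣-m p∣u-v))
      where
      v∸u<p : v ∸ u < p
      v∸u<p = ℕP.≤-<-trans (ℕP.m∸n≤m v u) (ℕP.<-≤-trans v<h (ℕ.s≤s (ℕP.m≤m+n m m)))

    ¬p∣A*[u+v] : ¬ (+ p S.∣ A * (+ u + + v))
    ¬p∣A*[u+v] p∣A[u+v] =
      [ ¬p∣A , (λ p∣u+v → ¬∣-small 0<u+v u+v<p (subst (+ p S.∣_) (sym (ℤP.pos-+ u v)) p∣u+v)) ]′
      (euclid p-prime A (+ u + + v) p∣A[u+v])
      where
      0<u+v : 0 < u ℕ.+ v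
      0<u+v = ℕP.<-≤-trans (ℕP.≤-<-trans ℕ.z≤n u<v) (ℕP.m≤n+m v u)
      v≤m = ℕP.≤-pred v<h
      u+v<p : u ℕ.+ v < p
      u+v<p = ℕ.s≤s (ℕP.≤-trans (ℕP.<⇒≤ (ℕP.+-monoˡ-< v u<v)) (ℕP.+-mono-≤ v≤m v≤m))

    byFactors : (Σ ℤ λ K → pol A (centre U + + u) - pol A (centre U + + v)
                              ≡ (+ u - + v) * (A * (+ u + + v) + + p * K)) → ⊥
    byFactors (K , difference≡) =
      [ ¬p∣u-v
      , (λ p∣sum → ¬p∣A*[u+v] (S.∣m+n∣n⇒∣m p∣sum (S.∣m⇒∣m*n K (S.∣-refl {+ p})))) ]′
        (euclid p-prime (+ u - + v) (A * (+ u + + v) + + p * K)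
              (subst (+ p S.∣_) difference≡ p∣difference))

  -- If p ∤ A and p ∤ B then every M is congruent to some pol A x₁ + pol B x₂
  -- modulo p: the h values pol A (s + u) and the h values M - pol B (s′ + v)
  -- are 2h = p + 1 residues, so two of them agree (pigeonhole), and by
  -- `distinct` the collision is between one of each kind.
  twoVariables : ∀ {A B} → ¬ (+ p S.∣ A) → ¬ (+ p S.∣ B) → ∀ M →
    Σ ℤ λ x₁ → Σ ℤ λ x₂ → + p S.∣ pol A x₁ + pol B x₂ - M
  twoVariables {A} {B} ¬p∣A ¬p∣B M =
    fromCollision (pigeonhole p<h+h (λ i → residue (toℕ i) (toℕ i <? h)))
    where
    U = prime⇒unit p-prime A ¬p∣A
    V = prime⇒unit p-prime B ¬p∣B

    candidate : ∀ i → Dec (i < h) → ℤ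
    candidate i (yes _) = pol A (centre U + + i)
    candidate i (no _)  = M - pol B (centre V + + (i ∸ h))

    residue : ∀ i → Dec (i < h) → Fin p
    residue i i<h? = fromℕ< (ℤDM.n%d<d (candidate i i<h?) (+ p))

    p<h+h : p < h ℕ.+ h
    p<h+h = ℕ.s≤s (ℕP.+-monoʳ-< m (ℕP.n<1+n m))

    collide : ∀ {i j} → i < j → j < h ℕ.+ h → (i<h? : Dec (i < h)) (j<h? : Dec (j < h)) →
      + p S.∣ candidate i i<h? - candidate j j<h? →
      Σ ℤ λ x₁ → Σ ℤ λ x₂ → + p S.∣ pol A x₁ + pol B x₂ - M
    collide i<j _ (yes _) (yes j<h) p∣ = ⊥-elim (distinct ¬p∣A U i<j j<h p∣)
    collide {i} {j} _ _ (yes _) (no _) p∣ =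
      centre U + + i , centre V + + (j ∸ h) ,
      subst (+ p S.∣_) (regroup (pol A (centre U + + i)) (pol B (centre V + + (j ∸ h))) M) p∣
      where
      regroup : ∀ G₁ G₂ M → G₁ - (M - G₂) ≡ G₁ + G₂ - M
      regroup = solve-∀
    collide i<j _ (no i≮h) (yes j<h) _ = ⊥-elim (i≮h (ℕP.<-trans i<j j<h))
    collide {i} {j} i<j j<2h (no i≮h) (no _) p∣ =
      ⊥-elim (distinct ¬p∣B V (ℕP.∸-monoˡ-< i<j (ℕP.≮⇒≥ i≮h)) (ℕP.m<n+o⇒m∸n<o j h j<2h)
                (subst (+ p S.∣_) (cancel M (pol B (centre V + + (i ∸ h))) (pol B (centre V + + (j ∸ h))))
                       (S.∣m⇒∣-m p∣)))
      where
      cancel : ∀ M Gᵢ Gⱼ → - ((M - Gᵢ) - (M - Gⱼ)) ≡ Gᵢ - Gⱼ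
      cancel = solve-∀

    fromCollision : (Σ (Fin (h ℕ.+ h)) λ i → Σ (Fin (h ℕ.+ h)) λ j →
                       toℕ i < toℕ j × residue (toℕ i) (toℕ i <? h) ≡ residue (toℕ j) (toℕ j <? h)) →
                    Σ ℤ λ x₁ → Σ ℤ λ x₂ → + p S.∣ pol A x₁ + pol B x₂ - M
    fromCollision (i , j , i<j , same) = collide i<j (toℕ<n j) i<h? j<h?
      (%-≡⇒∣- (candidate (toℕ i) i<h?) (candidate (toℕ j) j<h?) (+ p)
        (trans (sym (toℕ-fromℕ< (ℤDM.n%d<d (candidate (toℕ i) i<h?) (+ p))))
          (trans (cong toℕ same) (toℕ-fromℕ< (ℤDM.n%d<d (candidate (toℕ j) j<h?) (+ p))))))
      where
      i<h? = toℕ i <? h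
      j<h? = toℕ j <? h

  ¬∣2* : ∀ {C} → ¬ (+ p S.∣ C) → ¬ (+ p S.∣ + 2 * C)
  ¬∣2* {C} ¬p∣C p∣2C with euclid p-prime (+ 2) C p∣2C
  ... | inj₁ p∣2 = ¬∣-small (ℕ.s≤s ℕ.z≤n) (2<oddPrime m p-prime) p∣2
  ... | inj₂ p∣C = ¬p∣C p∣C

  -- For p ∤ C the derivative 2 C x + (2 - C) is a unit at x = 0 or at x = 1,
  -- since the two values differ by 2C.
  nonsingular : ∀ C → ¬ (+ p S.∣ C) → Σ ℤ λ x₀ → ¬ (+ p S.∣ + 2 * C * x₀ + (+ 2 - C))
  nonsingular C ¬p∣C with + p S.∣? + 2 * C * + 0 + (+ 2 - C) | + p S.∣? + 2 * C * + 1 + (+ 2 - C)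
  ... | no ¬p∣D₀ | _          = + 0 , ¬p∣D₀
  ... | yes _    | no ¬p∣D₁   = + 1 , ¬p∣D₁
  ... | yes p∣D₀ | yes p∣D₁   =
    ⊥-elim (¬∣2* ¬p∣C (subst (+ p S.∣_) (gap C) (S.∣m∣n⇒∣m-n p∣D₁ p∣D₀)))
    where
    gap : ∀ C → (+ 2 * C * + 1 + (+ 2 - C)) - (+ 2 * C * + 0 + (+ 2 - C)) ≡ + 2 * C
    gap = solve-∀

  unitsCase : ∀ {A B C N} → ¬ (+ p S.∣ A) → ¬ (+ p S.∣ B) → ¬ (+ p S.∣ C) →
              PolygonalRep p A B C N
  unitsCase {A} {B} {C} {N} ¬p∣A ¬p∣B ¬p∣C = lastCoordinate x₁ x₂
      (hensel C (+ 2 - C) (pol A x₁ + pol B x₂ - + 2 * N) x₃ (prime⇒unit p-prime _ ¬p∣D)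
              (subst (+ p S.∣_) (regroup (pol A x₁) (pol B x₂) C x₃ (+ 2 * N)) p∣))
    where
    x₃ = proj₁ (nonsingular C ¬p∣C)
    ¬p∣D = proj₂ (nonsingular C ¬p∣C)
    solution₁₂ = twoVariables ¬p∣A ¬p∣B (+ 2 * N - pol C x₃)
    x₁ = proj₁ solution₁₂
    x₂ = proj₁ (proj₂ solution₁₂)
    p∣ = proj₂ (proj₂ solution₁₂)
    regroup : ∀ G₁ G₂ C x M →
      G₁ + G₂ - (M - (C * x * x + (+ 2 - C) * x)) ≡ C * x * x + (+ 2 - C) * x + (G₁ + G₂ - M)
    regroup = solve-∀

  oddPrimeRep : ∀ A B C N → PolygonalRep p A B C N
  oddPrimeRep A B C N with + p S.∣? A | + p S.∣? B | + p S.∣? C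
  ... | yes p∣A | _       | _       = rotate (divisibleLast p∣A)
  ... | no _    | yes p∣B | _       = rotate (rotate (divisibleLast p∣B))
  ... | no _    | no _    | yes p∣C = divisibleLast p∣C
  ... | no ¬p∣A | no ¬p∣B | no ¬p∣C = unitsCase ¬p∣A ¬p∣B ¬p∣C

parity : ∀ n → Σ ℕ λ m → n ≡ m ℕ.+ m ⊎ n ≡ suc (m ℕ.+ m)
parity zero    = 0 , inj₁ refl
parity (suc n) with parity n
... | m , inj₁ n≡2m   = m , inj₂ (cong suc n≡2m)
... | m , inj₂ n≡2m+1 = suc m , inj₁ (trans (cong suc n≡2m+1) (cong suc (sym (ℕP.+-suc m m))))

oddPrime : ∀ {p} → Prime p → p ≢ 2 → Σ ℕ λ m → p ≡ suc (m ℕ.+ m)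
oddPrime {p} p-prime p≢2 = fromParity (parity p)
  where
  m+m≡m*2 : ∀ m → m ℕ.+ m ≡ m ℕ.* 2
  m+m≡m*2 m = trans (cong (m ℕ.+_) (sym (ℕP.+-identityʳ m))) (ℕP.*-comm 2 m)

  fromParity : (Σ ℕ λ m → p ≡ m ℕ.+ m ⊎ p ≡ suc (m ℕ.+ m)) → Σ ℕ λ m → p ≡ suc (m ℕ.+ m)
  fromParity (m , inj₂ p≡2m+1) = m , p≡2m+1
  fromParity (m , inj₁ p≡2m) with prime⇒irreducible p-prime (ℕD.divides m (trans p≡2m (m+m≡m*2 m)))
  ... | inj₁ ()
  ... | inj₂ 2≡p = ⊥-elim (p≢2 (sym 2≡p))

localRep : ∀ {a b c} N → ¬ (4 ∣ a × 4 ∣ b × 4 ∣ c) → ∀ {p} → Prime p →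
           PolygonalRep p (+ a - + 2) (+ b - + 2) (+ c - + 2) N
localRep N ¬4∣abc {p} p-prime with p ℕ.≟ 2
... | yes refl = twoAdicRep N ¬4∣abc
... | no p≢2 with oddPrime p-prime p≢2
...   | m , refl = OddPrime.oddPrimeRep m p-prime _ _ _ N

-- The theorem: reduce to three polygonal numbers, which are represented in every ℤ_p.
lemma2p1 : (a b c : ℕ) → 3 ≤ a → 3 ≤ b → 3 ≤ c →
    ¬ (4 ∣ a × 4 ∣ b × 4 ∣ c) →
    (p : ℕ) → Prime p → (n : ℕ) →
    RepresentedBy p (scaledQshift a b c) (twoPowδ a b c * (lₙ a b c n + vabc a b c))
lemma2p1 a b c _ _ _ ¬4∣abc p p-prime n = fromPolygonal a b c n (localRep (+ n) ¬4∣abc p-prime)
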